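{- Let $P \in \mathcal{P}$ and $P' \in \mathcal{P}_{ext}$ be such that either $P \to P'$ (a standard reduction), or $P \to \sigma$ for some rate distribution $\sigma$ and there exists $\lambda$ with $(\lambda,[P']_\equiv) \in \sigma$. Then there exists $P'' \in \mathcal{P}$ such that $P'' \equiv P'$.
   Context: Let $\mathcal{X}$ be a set of channel names $x,y,z,w,\dots$ and let $\lambda$ range over $\mathbb{R}^+$ (rates). Terms of $\mathcal{P}$ are generated by $P ::= M \mid P \,|\, P' \mid (\nu x)P \mid A(x_1,\dots,x_n)$, $M ::= \mathbf{0} \mid \alpha.P \mid M + M'$, $\alpha ::= \overline{x}\langle y\rangle \mid x(y) \mid \tau \mid (\lambda)$, where constants are given by a fixed set of definitions $A(\tilde{x}) \stackrel{def}{=} P$ which are weakly guarded: starting from the defining term and performing finitely many successive substitutions of constants by their defining terms, one reaches a term in which every constant occurs in the scope of a prefix. Let $\mathcal{QN}$ be a set of stochastic names $q,q',\dots$ disjoint from $\mathcal{X}$, and let $\theta$ range over $\mathcal{X}\cup\mathcal{QN}$. The extended set $\mathcal{P}_{ext}$ is generated by the same grammar with, additionally, terms $(\nu q \rightarrow \lambda)P$ (a stochastic binder binding $q$ and assigning it rate $\lambda$) and prefixes $\alpha ::= (q)$. One writes $(\nu x \rightarrow \varepsilon)$ for $(\nu x)$, and $(\nu \theta \rightarrow \hat\lambda)$ for an arbitrary binder with $\hat\lambda \in \mathbb{R}^+\cup\{\varepsilon\}$. Structural congruence $\equiv$ on $\mathcal{P}_{ext}$ is the smallest congruence including alpha-renaming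 of bound names and the laws: $(\nu\theta\rightarrow\hat\lambda)P \,|\, Q \equiv (\nu\theta\rightarrow\hat\lambda)(P\,|\,Q)$ if $\theta\notin fn(Q)$; $(\nu\theta\rightarrow\hat\lambda)(\nu\theta'\rightarrow\hat\lambda')P \equiv (\nu\theta'\rightarrow\hat\lambda')(\nu\theta\rightarrow\hat\lambda)P$ if $\theta\neq\theta'$; $(\nu\theta\rightarrow\hat\lambda)\mathbf{0}\equiv\mathbf{0}$; $(M_1+M_2)+M_3 \equiv M_1+(M_2+M_3)$; $M+N\equiv N+M$; $M+\mathbf{0}\equiv M$; $(P_1|P_2)|P_3\equiv P_1|(P_2|P_3)$; $P|Q\equiv Q|P$; $P|\mathbf{0}\equiv P$; $A(\tilde y)\equiv P\{\tilde y/\tilde x\}$ if $A(\tilde x)\stackrel{def}{=}P$; and $(\lambda).P + M \equiv (\nu q\rightarrow\lambda)((q).P+M)$ if $q\notin fn(M,P)$. Transitions $P \xrightarrow{\hat q} P'$ with $\hat q \in \mathcal{QN}\cup\{\varepsilon\}$ (an $\varepsilon$-label is written $P\to P'$, a standard reduction) are the smallest relation on $\mathcal{P}_{ext}$ closed under: $(q).P+M \xrightarrow{q} P$; $\tau.P+M \to P$; $x(z).P+M \,|\, \overline{x}\langle y\rangle.Q+N \to P\{y/z\}\,|\,Q$; if $P\xrightarrow{\hat q}P'$ then $P|Q\xrightarrow{\hat q}P'|Q$; if $P\xrightarrow{\hat q}P'$ and $\theta\neq\hat q$ then $(\nu\theta\rightarrow\hat\lambda)P \xrightarrow{\hat q}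 (\nu\theta\rightarrow\hat\lambda)P'$; if $P\equiv Q$, $Q\xrightarrow{\hat q}Q'$, $Q'\equiv P'$ then $P\xrightarrow{\hat q}P'$. A rate distribution is a non-empty finite multiset of pairs $(\lambda, e)$ with $\lambda\in\mathbb{R}^+$ and $e \in \mathcal{P}_{ext}/\!\equiv$. For a rate distribution $\sigma$, $(\nu q\rightarrow\lambda)\sigma$ denotes the multiset $\{\!|\,(\lambda',[(\nu q\rightarrow\lambda)P]_\equiv) \mid (\lambda',[P]_\equiv)\in\sigma\,|\!\}$; $\cup$ is multiset union. Stochastic transitions $P\to\sigma$ are the least relation (well-defined by stratification) closed under: (Sto1) if $P\to\sigma$ and $P\xrightarrow{q}P'$ then $(\nu q\rightarrow\lambda)P \to (\nu q\rightarrow\lambda)\sigma \cup \{\!|(\lambda,[(\nu q\rightarrow\lambda)P']_\equiv)|\!\}$; (Sto2) if there is no $\sigma$ with $P\to\sigma$, and $P\xrightarrow{q}P'$, then $(\nu q\rightarrow\lambda)P\to\{\!|(\lambda,[(\nu q\rightarrow\lambda)P']_\equiv)|\!\}$; (StoCong) if $P\equiv Q$ and $Q\to\sigma$ then $P\to\sigma$. -}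

module Defs where

open import Data.Nat using (ℕ; zero; suc)
open import Data.Fin using (Fin; zero; suc)
open import Data.Vec using (Vec; lookup)
open import Data.Vec as Vec using ()
open import Data.List using (List; []; _∷_; _++_)
open import Data.List as List using ()
open import Data.List.Membership.Propositional using (_∈_)
open import Data.Maybe using (Maybe; just; nothing)
open import Data.Maybe as Maybe using ()
open import Data.Product using (Σ; ∃; _×_; _,_; proj₁; proj₂)
open import Relation.Nullary using (¬_)
open import Relation.Binary.Construct.Closure.ReflexiveTransitive using (Star)
open import Function.Bundles using (_⇔_)

-- Standing data of the calculus:
--   Rate : the set of rates (R⁺ in the paper; kept abstract, rates are never inspected)
--   K    : the (fixed) set of constant identifiers A
--   ar   : the arity of each constant
-- Syntax is well-scoped de Bruijn (so alpha-renaming of bound names is built in):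
--   Proc n m / Sum n m have n channel names (Fin n) and m stochastic names (Fin m) in scope.
module Calculus (Rate : Set) (K : Set) (ar : K → ℕ) where

  mutual
    data Proc (n m : ℕ) : Set where
      sm   : Sum n m → Proc n m
      _∣_  : Proc n m → Proc n m → Proc n m
      νc   : Proc (suc n) m → Proc n m
      νs   : Rate → Proc n (suc m) → Proc n m
      call : (k : K) → Vec (Fin n) (ar k) → Proc n m

    data Sum (n m : ℕ) : Set where
      𝟘    : Sum n m
      _⊕_  : Sum n m → Sum n m → Sum n m
      out  : Fin n → Fin n → Proc n m → Sum n m
      inp  : Fin n → Proc (suc n) m → Sum n m          -- x(y).P  (y bound, index 0)
      tau  : Proc n m → Sum n m
      rate : Rate → Proc n m → Sum n m
      sto  : Fin m → Proc n m → Sum n m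

  infixr 5 _∣_
  infixr 6 _⊕_

  ext : ∀ {a b} → (Fin a → Fin b) → Fin (suc a) → Fin (suc b)
  ext ρ zero    = zero
  ext ρ (suc i) = suc (ρ i)

  mutual
    ren : ∀ {n n' m m'} → (Fin n → Fin n') → (Fin m → Fin m') → Proc n m → Proc n' m'
    ren ρ χ (sm M)        = sm (renS ρ χ M)
    ren ρ χ (P ∣ Q)       = ren ρ χ P ∣ ren ρ χ Q
    ren ρ χ (νc P)        = νc (ren (ext ρ) χ P)
    ren ρ χ (νs l P)      = νs l (ren ρ (ext χ) P)
    ren ρ χ (call k ys)   = call k (Vec.map ρ ys)

    renS : ∀ {n n' m m'} → (Fin n → Fin n') → (Fin m → Fin m') → Sum n m → Sum n' m'
    renS ρ χ 𝟘            = 𝟘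
    renS ρ χ (M ⊕ N)      = renS ρ χ M ⊕ renS ρ χ N
    renS ρ χ (out x y P)  = out (ρ x) (ρ y) (ren ρ χ P)
    renS ρ χ (inp x P)    = inp (ρ x) (ren (ext ρ) χ P)
    renS ρ χ (tau P)      = tau (ren ρ χ P)
    renS ρ χ (rate l P)   = rate l (ren ρ χ P)
    renS ρ χ (sto q P)    = sto (χ q) (ren ρ χ P)

  idF : ∀ {a} → Fin a → Fin a
  idF i = i

  -- weakening (a fresh name is bound at index 0, so the old names shift up)
  wkC : ∀ {n m} → Proc n m → Proc (suc n) m
  wkC = ren suc idF

  wkS : ∀ {n m} → Proc n m → Proc n (suc m)
  wkS = ren idF suc

  wkSumS : ∀ {n m} → Sum n m → Sum n (suc m)
  wkSumS = renS idF suc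

  swap : ∀ {a} → Fin (suc (suc a)) → Fin (suc (suc a))
  swap zero          = suc zero
  swap (suc zero)    = zero
  swap (suc (suc i)) = suc (suc i)

  sub0 : ∀ {n} → Fin n → Fin (suc n) → Fin n
  sub0 y zero    = y
  sub0 y (suc i) = i

  noStoch : ∀ {m} → Fin 0 → Fin m
  noStoch ()

  -- instantiation P{ỹ/x̃} of the defining term of a constant (defining terms lie in 𝒫,
  -- so they have no free stochastic names)
  inst : ∀ {n m} (k : K) → Vec (Fin n) (ar k) → Proc (ar k) 0 → Proc n m
  inst k ys B = ren (lookup ys) noStoch B

  mutual
    -- membership in 𝒫: no stochastic binders (ν q → λ) and no prefixes (q)
    data IsStd {n m : ℕ} : Proc n m → Set where
      sm   : ∀ {M} → IsStdS M → IsStd (sm M)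
      par  : ∀ {P Q} → IsStd P → IsStd Q → IsStd (P ∣ Q)
      νc   : ∀ {P} → IsStd P → IsStd (νc P)
      call : ∀ {k ys} → IsStd (call k ys)

    data IsStdS {n m : ℕ} : Sum n m → Set where
      𝟘    : IsStdS 𝟘
      _⊕_  : ∀ {M N} → IsStdS M → IsStdS N → IsStdS (M ⊕ N)
      out  : ∀ {x y P} → IsStd P → IsStdS (out x y P)
      inp  : ∀ {x P} → IsStd P → IsStdS (inp x P)
      tau  : ∀ {P} → IsStd P → IsStdS (tau P)
      rate : ∀ {l P} → IsStd P → IsStdS (rate l P)

  mutual
    data Guarded {n m : ℕ} : Proc n m → Set where
      sm   : ∀ {M} → GuardedS M → Guarded (sm M)
      par  : ∀ {P Q} → Guarded P → Guarded Q → Guarded (P ∣ Q)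
      νc   : ∀ {P} → Guarded P → Guarded (νc P)
      νs   : ∀ {l P} → Guarded P → Guarded (νs l P)

    data GuardedS {n m : ℕ} : Sum n m → Set where
      𝟘    : GuardedS 𝟘
      _⊕_  : ∀ {M N} → GuardedS M → GuardedS N → GuardedS (M ⊕ N)
      out  : ∀ {x y P} → GuardedS (out x y P)
      inp  : ∀ {x P} → GuardedS (inp x P)
      tau  : ∀ {P} → GuardedS (tau P)
      rate : ∀ {l P} → GuardedS (rate l P)
      sto  : ∀ {q P} → GuardedS (sto q P)

  -- Everything below depends on the fixed set of definitions A(x̃) ≝ body A
  module WithDefs (body : (k : K) → Proc (ar k) 0) where

    mutual
      data Unfold : {n m : ℕ} → Proc n m → Proc n m → Set where
        here  : ∀ {n m} {k} {ys : Vec (Fin n) (ar k)} →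
                Unfold {n} {m} (call k ys) (inst k ys (body k))
        sm    : ∀ {n m} {M M' : Sum n m} → UnfoldS M M' → Unfold (sm M) (sm M')
        parL  : ∀ {n m} {P P' Q : Proc n m} → Unfold P P' → Unfold (P ∣ Q) (P' ∣ Q)
        parR  : ∀ {n m} {P Q Q' : Proc n m} → Unfold Q Q' → Unfold (P ∣ Q) (P ∣ Q')
        νc    : ∀ {n m} {P P' : Proc (suc n) m} → Unfold P P' → Unfold (νc P) (νc P')
        νs    : ∀ {n m l} {P P' : Proc n (suc m)} → Unfold P P' → Unfold (νs l P) (νs l P')

      data UnfoldS : {n m : ℕ} → Sum n m → Sum n m → Set where
        sumL  : ∀ {n m} {M M' N : Sum n m} → UnfoldS M M' → UnfoldS (M ⊕ N) (M' ⊕ N)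
        sumR  : ∀ {n m} {M N N' : Sum n m} → UnfoldS N N' → UnfoldS (M ⊕ N) (M ⊕ N')
        out   : ∀ {n m x y} {P P' : Proc n m} → Unfold P P' → UnfoldS (out x y P) (out x y P')
        inp   : ∀ {n m x} {P P' : Proc (suc n) m} → Unfold P P' → UnfoldS (inp x P) (inp x P')
        tau   : ∀ {n m} {P P' : Proc n m} → Unfold P P' → UnfoldS (tau P) (tau P')
        rate  : ∀ {n m l} {P P' : Proc n m} → Unfold P P' → UnfoldS (rate l P) (rate l P')
        sto   : ∀ {n m q} {P P' : Proc n m} → Unfold P P' → UnfoldS (sto q P) (sto q P')

    WeaklyGuarded : Set
    WeaklyGuarded = ∀ k → ∃ λ (Q : Proc (ar k) 0) → Star Unfold (body k) Q × Guarded Q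

    -- structural congruence ≡ (written ≈P on processes, ≈S on sums)
    infix 4 _≈P_ _≈S_
    mutual
      data _≈P_ : {n m : ℕ} → Proc n m → Proc n m → Set where
        refl   : ∀ {n m} {P : Proc n m} → P ≈P P
        sym    : ∀ {n m} {P Q : Proc n m} → P ≈P Q → Q ≈P P
        trans  : ∀ {n m} {P Q R : Proc n m} → P ≈P Q → Q ≈P R → P ≈P R
        sm     : ∀ {n m} {M M' : Sum n m} → M ≈S M' → sm M ≈P sm M'
        par    : ∀ {n m} {P P' Q Q' : Proc n m} → P ≈P P' → Q ≈P Q' → (P ∣ Q) ≈P (P' ∣ Q')
        νc     : ∀ {n m} {P P' : Proc (suc n) m} → P ≈P P' → νc P ≈P νc P'
        νs     : ∀ {n m l} {P P' : Proc n (suc m)} → P ≈P P' → νs l P ≈P νs l P'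
        extrC  : ∀ {n m} {P : Proc (suc n) m} {Q : Proc n m} → (νc P ∣ Q) ≈P νc (P ∣ wkC Q)
        extrS  : ∀ {n m l} {P : Proc n (suc m)} {Q : Proc n m} → (νs l P ∣ Q) ≈P νs l (P ∣ wkS Q)
        swapCC : ∀ {n m} {P : Proc (suc (suc n)) m} → νc (νc P) ≈P νc (νc (ren swap idF P))
        swapSS : ∀ {n m l l'} {P : Proc n (suc (suc m))} →
                 νs l (νs l' P) ≈P νs l' (νs l (ren idF swap P))
        swapCS : ∀ {n m l} {P : Proc (suc n) (suc m)} → νc (νs l P) ≈P νs l (νc P)
        nilC   : ∀ {n m} → νc (sm 𝟘) ≈P sm {n} {m} 𝟘
        nilS   : ∀ {n m l} → νs l (sm 𝟘) ≈P sm {n} {m} 𝟘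
        parA   : ∀ {n m} {P Q R : Proc n m} → ((P ∣ Q) ∣ R) ≈P (P ∣ (Q ∣ R))
        parC   : ∀ {n m} {P Q : Proc n m} → (P ∣ Q) ≈P (Q ∣ P)
        parU   : ∀ {n m} {P : Proc n m} → (P ∣ sm 𝟘) ≈P P
        unfold : ∀ {n m} {k} {ys : Vec (Fin n) (ar k)} → call {n} {m} k ys ≈P inst k ys (body k)
        rateν  : ∀ {n m l} {P : Proc n m} {M : Sum n m} →
                 sm (rate l P ⊕ M) ≈P νs l (sm (sto zero (wkS P) ⊕ wkSumS M))

      data _≈S_ : {n m : ℕ} → Sum n m → Sum n m → Set where
        refl   : ∀ {n m} {M : Sum n m} → M ≈S M
        sym    : ∀ {n m} {M N : Sum n m} → M ≈S N → N ≈S M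
        trans  : ∀ {n m} {M N L : Sum n m} → M ≈S N → N ≈S L → M ≈S L
        sum    : ∀ {n m} {M M' N N' : Sum n m} → M ≈S M' → N ≈S N' → (M ⊕ N) ≈S (M' ⊕ N')
        out    : ∀ {n m x y} {P P' : Proc n m} → P ≈P P' → out x y P ≈S out x y P'
        inp    : ∀ {n m x} {P P' : Proc (suc n) m} → P ≈P P' → inp x P ≈S inp x P'
        tau    : ∀ {n m} {P P' : Proc n m} → P ≈P P' → tau P ≈S tau P'
        rate   : ∀ {n m l} {P P' : Proc n m} → P ≈P P' → rate l P ≈S rate l P'
        sto    : ∀ {n m q} {P P' : Proc n m} → P ≈P P' → sto q P ≈S sto q P'
        sumA   : ∀ {n m} {M N L : Sum n m} → ((M ⊕ N) ⊕ L) ≈S (M ⊕ (N ⊕ L))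
        sumC   : ∀ {n m} {M N : Sum n m} → (M ⊕ N) ≈S (N ⊕ M)
        sumU   : ∀ {n m} {M : Sum n m} → (M ⊕ 𝟘) ≈S M

    -- labelled transitions  P —[ q̂ ]→ P'   (q̂ = nothing is ε, i.e. a standard reduction)
    infix 4 _—[_]→_
    data _—[_]→_ : {n m : ℕ} → Proc n m → Maybe (Fin m) → Proc n m → Set where
      stoT  : ∀ {n m q} {P : Proc n m} {M} → sm (sto q P ⊕ M) —[ just q ]→ P
      tauT  : ∀ {n m} {P : Proc n m} {M} → sm (tau P ⊕ M) —[ nothing ]→ P
      comT  : ∀ {n m x y} {P : Proc (suc n) m} {Q : Proc n m} {M N} →
              (sm (inp x P ⊕ M) ∣ sm (out x y Q ⊕ N)) —[ nothing ]→ (ren (sub0 y) idF P ∣ Q)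
      parT  : ∀ {n m l} {P P' Q : Proc n m} → P —[ l ]→ P' → (P ∣ Q) —[ l ]→ (P' ∣ Q)
      -- restriction of a channel name (never equal to a label)
      resC  : ∀ {n m l} {P P' : Proc (suc n) m} → P —[ l ]→ P' → νc P —[ l ]→ νc P'
      -- restriction of a stochastic name q (index 0): the label must differ from q
      resS  : ∀ {n m r} {l : Maybe (Fin m)} {P P' : Proc n (suc m)} →
              P —[ Maybe.map suc l ]→ P' → νs r P —[ l ]→ νs r P'
      congT : ∀ {n m l} {P Q Q' P' : Proc n m} →
              P ≈P Q → Q —[ l ]→ Q' → Q' ≈P P' → P —[ l ]→ P'

    -- rate distributions, represented by lists of (rate, representative) pairs
    Dist : ℕ → ℕ → Set
    Dist n m = List (Rate × Proc n m)

    νDist : ∀ {n m} → Rate → Dist n (suc m) → Dist n m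
    νDist l = List.map (λ p → proj₁ p , νs l (proj₂ p))

    _∈D_ : ∀ {n m} → Rate × Proc n m → Dist n m → Set
    (l , P') ∈D σ = ∃ λ Q → ((l , Q) ∈ σ) × (Q ≈P P')

    StoRel : Set₁
    StoRel = ∀ {n m} → Proc n m → Dist n m → Set

    -- The rules (Sto1), (Sto2), (StoCong), with the negative premise of (Sto2)
    -- evaluated against a given relation S (this is how a stratified definition
    -- with negative premises is expressed).
    data StoRules (S : StoRel) : {n m : ℕ} → Proc n m → Dist n m → Set where
      sto1    : ∀ {n m l} {P P' : Proc n (suc m)} {σ} →
                StoRules S P σ → P —[ just zero ]→ P' →
                StoRules S (νs l P) (νDist l σ ++ ((l , νs l P') ∷ []))
      sto2    : ∀ {n m l} {P P' : Proc n (suc m)} →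
                ¬ (∃ λ σ → S P σ) → P —[ just zero ]→ P' →
                StoRules S (νs l P) ((l , νs l P') ∷ [])
      stoCong : ∀ {n m} {P Q : Proc n m} {σ} → P ≈P Q → StoRules S Q σ → StoRules S P σ

    -- S is the stochastic transition relation P → σ: it is the least relation closed
    -- under the rules, where the negative premise refers to S itself.
    IsStoTransition : StoRel → Set
    IsStoTransition S = ∀ {n m} (P : Proc n m) (σ : Dist n m) → S P σ ⇔ StoRules S P σ

module Submission where

-- A term of 𝒫 has no free stochastic names. Call a term linear when every binder (ν q → λ) binds
-- at most one occurrence of q, necessarily a prefix (q).R, and no continuation of a prefix has free
-- stochastic names: the law (λ).P + M ≡ (ν q → λ)((q).P + M) creates exactly such binders.
-- Structural congruence preserves linearity together with the multiset of free stochastic names up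
-- to permutation (for terms whose free names are distinct), while reductions and stochastic
-- transitions preserve linearity and can only lose free stochastic names. Hence every P' reached
-- from P ∈ 𝒫 is linear without free stochastic names. There each binder can be pushed by scope
-- extrusion down to its summand (q).R and removed by reading that law backwards, and a binder-free
-- term without free stochastic names lies in 𝒫.

open import Defs

open import Data.Nat using (ℕ; zero; suc)
open import Data.Fin using (Fin; zero; suc; _≟_)
open import Data.Fin.Properties using (suc-injective)
open import Data.List using (List; []; _∷_; _++_; map; mapMaybe)
open import Data.List.Properties
  using (++-conicalˡ; ++-conicalʳ; map-++; map-id; mapMaybe-++; mapMaybe-map; mapMaybe-just; mapMaybe-cong;
         map-mapMaybe)
open import Data.List.Membership.Propositional using (_∈_; _∉_)
open import Data.List.Membership.Propositional.Properties using (∈-map⁻; ∈-++⁺ˡ; ∈-++⁺ʳ; ∈-++⁻)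
open import Data.List.Relation.Unary.Any using (here; there; any?)
open import Data.List.Relation.Unary.All as All using (All)
import Data.List.Relation.Unary.All.Properties as All
open import Data.List.Relation.Unary.Unique.Propositional using (Unique; []; _∷_)
import Data.List.Relation.Unary.Unique.Propositional.Properties as Unique
open import Data.List.Relation.Binary.Disjoint.Propositional using (Disjoint)
open import Data.List.Relation.Binary.Permutation.Propositional
  using (_↭_; ↭-refl; ↭-reflexive; ↭-sym; ↭-trans; ↭-prep; ↭⇒↭ₛ)
import Data.List.Relation.Binary.Permutation.Propositional.Properties as ↭
import Data.List.Relation.Binary.Permutation.Setoid.Properties as ↭ₛ
open import Data.Maybe as Maybe using (Maybe; just; nothing)
open import Data.Product using (Σ; ∃; _×_; _,_; proj₁; proj₂)
open import Data.Sum using (_⊎_; inj₁; inj₂)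
open import Data.Unit using (⊤; tt)
open import Data.Empty using (⊥-elim)
open import Data.Vec using (Vec)
import Data.Vec as Vec
import Data.Vec.Properties as Vec
open import Function using (_∘_)
open import Function.Definitions using (Injective)
open import Function.Bundles using (Equivalence)
open import Relation.Nullary using (yes; no)
open import Relation.Binary.Bundles using (Setoid)
import Relation.Binary.Reasoning.Setoid as ≈-Reasoning
open import Relation.Binary.PropositionalEquality using (_≡_; _≗_; refl; cong; subst; setoid)
import Relation.Binary.PropositionalEquality as ≡

private variable
  A B : Set
  m : ℕ

Unique-resp-↭ : {xs ys : List A} → xs ↭ ys → Unique xs → Unique ys
Unique-resp-↭ p = ↭ₛ.Unique-resp-↭ (setoid _) (↭⇒↭ₛ p)

Unique-++⁻ˡ : ∀ (xs : List A) {ys} → Unique (xs ++ ys) → Unique xs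
Unique-++⁻ˡ []       _            = []
Unique-++⁻ˡ (x ∷ xs) (x∉ ∷ uniq) = All.++⁻ˡ xs x∉ ∷ Unique-++⁻ˡ xs uniq

Unique-++⁻ʳ : ∀ (xs : List A) {ys} → Unique (xs ++ ys) → Unique ys
Unique-++⁻ʳ []       uniq       = uniq
Unique-++⁻ʳ (x ∷ xs) (_ ∷ uniq) = Unique-++⁻ʳ xs uniq

Unique-++⇒Disjoint : ∀ (xs : List A) {ys} → Unique (xs ++ ys) → Disjoint xs ys
Unique-++⇒Disjoint (x ∷ xs) (x∉ ∷ _)    (here refl , v∈ys) = All.lookup (All.++⁻ʳ xs x∉) v∈ys refl
Unique-++⇒Disjoint (x ∷ xs) (_ ∷ uniq) (there v∈xs , v∈ys) = Unique-++⇒Disjoint xs uniq (v∈xs , v∈ys)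

map-≡[]⁻ : {f : A → B} (xs : List A) → map f xs ≡ [] → xs ≡ []
map-≡[]⁻ [] _ = refl

≡[]⇒∉ : {x : A} {xs : List A} → xs ≡ [] → x ∉ xs
≡[]⇒∉ refl ()

infix 4 _⊑_

_⊑_ : List A → List A → Set
xs ⊑ ys = ∃ λ zs → xs ++ zs ↭ ys

[]⊑ : {ys : List A} → [] ⊑ ys
[]⊑ {ys = ys} = ys , ↭-refl

⊑[]⇒≡[] : {xs : List A} → xs ⊑ [] → xs ≡ []
⊑[]⇒≡[] {xs = xs} (zs , p) = ++-conicalˡ xs zs (↭.↭-empty-inv p)

⊑-respʳ-↭ : {xs ys ys' : List A} → ys ↭ ys' → xs ⊑ ys → xs ⊑ ys'
⊑-respʳ-↭ p (zs , q) = zs , ↭-trans q p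

⊑-respˡ-↭ : {xs xs' ys : List A} → xs ↭ xs' → xs' ⊑ ys → xs ⊑ ys
⊑-respˡ-↭ p (zs , q) = zs , ↭-trans (↭.++⁺ʳ zs p) q

⊑-++⁺ʳ : {xs ys : List A} (zs : List A) → xs ⊑ ys → xs ++ zs ⊑ ys ++ zs
⊑-++⁺ʳ {xs = xs} zs (ws , p) = ws , ↭-trans xs+zs+ws↭xs+ws+zs (↭.++⁺ʳ zs p)
  where
  xs+zs+ws↭xs+ws+zs : (xs ++ zs) ++ ws ↭ (xs ++ ws) ++ zs
  xs+zs+ws↭xs+ws+zs = ↭-trans (↭.++-assoc xs zs ws)
    (↭-trans (↭.++⁺ˡ xs (↭.++-comm zs ws)) (↭-sym (↭.++-assoc xs ws zs)))

Unique-⊑ : {xs ys : List A} → xs ⊑ ys → Unique ys → Unique xs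
Unique-⊑ {xs = xs} (zs , p) uniq = Unique-++⁻ˡ xs (Unique-resp-↭ (↭-sym p) uniq)

unshift : Fin (suc m) → Maybe (Fin m)
unshift zero    = nothing
unshift (suc i) = just i

unbind : List (Fin (suc m)) → List (Fin m)
unbind = mapMaybe unshift

unbind-map-suc : (xs : List (Fin m)) → unbind (map suc xs) ≡ xs
unbind-map-suc xs = ≡.trans (mapMaybe-map unshift suc xs) (mapMaybe-just xs)

∈-unbind⁺ : {i : Fin m} (xs : List (Fin (suc m))) → suc i ∈ xs → i ∈ unbind xs
∈-unbind⁺ (zero  ∷ xs) (there i∈) = ∈-unbind⁺ xs i∈
∈-unbind⁺ (suc j ∷ xs) (here refl) = here refl
∈-unbind⁺ (suc j ∷ xs) (there i∈) = there (∈-unbind⁺ xs i∈)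

∈-unbind⁻ : {i : Fin m} (xs : List (Fin (suc m))) → i ∈ unbind xs → suc i ∈ xs
∈-unbind⁻ (zero  ∷ xs) i∈ = there (∈-unbind⁻ xs i∈)
∈-unbind⁻ (suc j ∷ xs) (here refl) = here refl
∈-unbind⁻ (suc j ∷ xs) (there i∈) = there (∈-unbind⁻ xs i∈)

Unique-unbind : {xs : List (Fin (suc m))} → Unique xs → Unique (unbind xs)
Unique-unbind []                         = []
Unique-unbind {xs = zero  ∷ xs} (_ ∷ uniq)  = Unique-unbind uniq
Unique-unbind {xs = suc i ∷ xs} (i∉ ∷ uniq) =
  All.¬Any⇒All¬ (unbind xs) (λ i∈ → All.All¬⇒¬Any i∉ (∈-unbind⁻ xs i∈)) ∷ Unique-unbind uniq

unbind-⊑ : {xs ys : List (Fin (suc m))} → xs ⊑ ys → unbind xs ⊑ unbind ys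
unbind-⊑ {xs = xs} (zs , p) = unbind zs , subst (_↭ _) (mapMaybe-++ unshift xs zs) (↭.mapMaybe-↭ unshift p)

Unique-extrude : {xs : List (Fin (suc m))} {ys : List (Fin m)} →
                 Unique xs → Unique (unbind xs ++ ys) → Unique (xs ++ map suc ys)
Unique-extrude {xs = xs} {ys} uxs uniq =
  Unique.++⁺ uxs (Unique.map⁺ suc-injective (Unique-++⁻ʳ (unbind xs) uniq)) disjoint
  where
  disjoint : Disjoint xs (map suc ys)
  disjoint (v∈xs , v∈sucys) with ∈-map⁻ suc v∈sucys
  ... | i , i∈ys , refl = Unique-++⇒Disjoint (unbind xs) uniq (∈-unbind⁺ xs v∈xs , i∈ys)

Unique-zero∷map-suc : {xs : List (Fin m)} → Unique xs → Unique (zero ∷ map suc xs)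
Unique-zero∷map-suc {xs = xs} u = All.map⁺ (All.universal (λ _ ()) xs) ∷ Unique.map⁺ suc-injective u

module StochasticNames (Rate K : Set) (ar : K → ℕ) where
  open Calculus Rate K ar

  private variable
    n n' m' : ℕ

  -- the free stochastic names, counted with multiplicity
  mutual
    fv : Proc n m → List (Fin m)
    fv (sm M)      = fvS M
    fv (P ∣ Q)     = fv P ++ fv Q
    fv (νc P)      = fv P
    fv (νs _ P)    = unbind (fv P)
    fv (call _ _)  = []

    fvS : Sum n m → List (Fin m)
    fvS 𝟘           = []
    fvS (M ⊕ N)     = fvS M ++ fvS N
    fvS (out _ _ P) = fv P
    fvS (inp _ P)   = fv P
    fvS (tau P)     = fv P
    fvS (rate _ P)  = fv P
    fvS (sto q P)   = q ∷ fv P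

  mutual
    Linear : Proc n m → Set
    Linear (sm M)     = LinearS M
    Linear (P ∣ Q)    = Linear P × Linear Q
    Linear (νc P)     = Linear P
    Linear (νs _ P)   = Linear P × Unique (fv P)
    Linear (call _ _) = ⊤

    LinearS : Sum n m → Set
    LinearS 𝟘           = ⊤
    LinearS (M ⊕ N)     = LinearS M × LinearS N
    LinearS (out _ _ P) = Linear P × fv P ≡ []
    LinearS (inp _ P)   = Linear P × fv P ≡ []
    LinearS (tau P)     = Linear P × fv P ≡ []
    LinearS (rate _ P)  = Linear P × fv P ≡ []
    LinearS (sto _ P)   = Linear P × fv P ≡ []

  -- ⟪ P ⟫ is what the invariant sees of P. The operations on profiles follow the clauses of fv and
  -- Linear, so that for instance ⟪ P ∣ Q ⟫ and ⟪ P ⟫ ⊗ ⟪ Q ⟫ coincide definitionally.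
  record Profile (m : ℕ) : Set₁ where
    constructor ⟨_,_⟩
    field
      names  : List (Fin m)
      linear : Set
  open Profile

  ⟪_⟫ : Proc n m → Profile m
  ⟪ P ⟫ = ⟨ fv P , Linear P ⟩

  ⟪_⟫ˢ : Sum n m → Profile m
  ⟪ M ⟫ˢ = ⟨ fvS M , LinearS M ⟩

  Proper : Profile m → Set
  Proper a = linear a × Unique (names a)

  _⊗_ : Profile m → Profile m → Profile m
  a ⊗ b = ⟨ names a ++ names b , linear a × linear b ⟩

  ε : Profile m
  ε = ⟨ [] , ⊤ ⟩

  guard : Profile m → Profile m
  guard a = ⟨ names a , linear a × names a ≡ [] ⟩

  bind : Profile (suc m) → Profile m
  bind a = ⟨ unbind (names a) , Proper a ⟩

  -- Linearity is transported only between terms with distinct free names: the binder of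
  -- (ν q → λ)(P | Q) asks for more than (ν q → λ)P | Q does.
  infix 4 _≃_
  record _≃_ (a b : Profile m) : Set where
    field
      names-↭ : names a ↭ names b
      linear⇒ : Proper a → linear b
      linear⇐ : Proper b → linear a
  open _≃_

  Proper-resp-≃ : {a b : Profile m} → a ≃ b → Proper a → Proper b
  Proper-resp-≃ a≃b pa = linear⇒ a≃b pa , Unique-resp-↭ (names-↭ a≃b) (proj₂ pa)

  ≃-refl : {a : Profile m} → a ≃ a
  ≃-refl = record { names-↭ = ↭-refl ; linear⇒ = proj₁ ; linear⇐ = proj₁ }

  ≃-sym : {a b : Profile m} → a ≃ b → b ≃ a
  ≃-sym a≃b = record
    { names-↭ = ↭-sym (names-↭ a≃b) ; linear⇒ = linear⇐ a≃b ; linear⇐ = linear⇒ a≃b }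

  ≃-trans : {a b c : Profile m} → a ≃ b → b ≃ c → a ≃ c
  ≃-trans a≃b b≃c = record
    { names-↭ = ↭-trans (names-↭ a≃b) (names-↭ b≃c)
    ; linear⇒ = λ pa → linear⇒ b≃c (Proper-resp-≃ a≃b pa)
    ; linear⇐ = λ pc → linear⇐ a≃b (Proper-resp-≃ (≃-sym b≃c) pc)
    }

  Proper-⊗⁻ : (a b : Profile m) → Proper (a ⊗ b) → Proper a × Proper b
  Proper-⊗⁻ a b ((la , lb) , uniq) = (la , Unique-++⁻ˡ (names a) uniq) , (lb , Unique-++⁻ʳ (names a) uniq)

  ≃-⊗ : {a a' b b' : Profile m} → a ≃ a' → b ≃ b' → a ⊗ b ≃ a' ⊗ b'
  ≃-⊗ {a = a} {a'} {b} {b'} a≃a' b≃b' = record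
    { names-↭ = ↭.++⁺ (names-↭ a≃a') (names-↭ b≃b')
    ; linear⇒ = λ p → let pa , pb = Proper-⊗⁻ a b p in linear⇒ a≃a' pa , linear⇒ b≃b' pb
    ; linear⇐ = λ p → let pa , pb = Proper-⊗⁻ a' b' p in linear⇐ a≃a' pa , linear⇐ b≃b' pb
    }

  ⊗-assoc : (a b c : Profile m) → (a ⊗ b) ⊗ c ≃ a ⊗ (b ⊗ c)
  ⊗-assoc a b c = record
    { names-↭ = ↭.++-assoc (names a) (names b) (names c)
    ; linear⇒ = λ { (((la , lb) , lc) , _) → la , (lb , lc) }
    ; linear⇐ = λ { ((la , (lb , lc)) , _) → (la , lb) , lc }
    }

  ⊗-comm : (a b : Profile m) → a ⊗ b ≃ b ⊗ a
  ⊗-comm a b = record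
    { names-↭ = ↭.++-comm (names a) (names b)
    ; linear⇒ = λ { ((la , lb) , _) → lb , la }
    ; linear⇐ = λ { ((lb , la) , _) → la , lb }
    }

  ⊗-identityʳ : (a : Profile m) → a ⊗ ε ≃ a
  ⊗-identityʳ a = record
    { names-↭ = ↭.++-identityʳ (names a)
    ; linear⇒ = λ { ((la , _) , _) → la }
    ; linear⇐ = λ { (la , _) → la , tt }
    }

  linear-guard-resp-≃ : {a b : Profile m} → a ≃ b → linear (guard a) → linear (guard b)
  linear-guard-resp-≃ {a = a} {b} a≃b (la , a≡[]) =
    linear⇒ a≃b (la , subst Unique (≡.sym a≡[]) []) ,
    ↭.↭-empty-inv (↭-sym (subst (_↭ names b) a≡[] (names-↭ a≃b)))

  ≃-guard : {a b : Profile m} → a ≃ b → guard a ≃ guard b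
  ≃-guard a≃b = record
    { names-↭ = names-↭ a≃b
    ; linear⇒ = linear-guard-resp-≃ a≃b ∘ proj₁
    ; linear⇐ = linear-guard-resp-≃ (≃-sym a≃b) ∘ proj₁
    }

  ≃-bind : {a b : Profile (suc m)} → a ≃ b → bind a ≃ bind b
  ≃-bind a≃b = record
    { names-↭ = ↭.mapMaybe-↭ unshift (names-↭ a≃b)
    ; linear⇒ = λ { (pa , _) → Proper-resp-≃ a≃b pa }
    ; linear⇐ = λ { (pb , _) → Proper-resp-≃ (≃-sym a≃b) pb }
    }

  infix 4 _≼_
  record _≼_ (a b : Profile m) : Set where
    constructor _,_
    field
      proper  : Proper a
      names-⊑ : names a ⊑ names b

  ≼-resp-≃ : {a a' b b' : Profile m} → a ≃ a' → b ≃ b' → a ≼ b → a' ≼ b'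
  ≼-resp-≃ a≃a' b≃b' (pa , a⊑b) =
    Proper-resp-≃ a≃a' pa , ⊑-respˡ-↭ (↭-sym (names-↭ a≃a')) (⊑-respʳ-↭ (names-↭ b≃b') a⊑b)

  Proper-bind : {a : Profile (suc m)} → Proper a → Proper (bind a)
  Proper-bind pa = pa , Unique-unbind (proj₂ pa)

  bind-≼ : {a b : Profile (suc m)} → a ≼ b → bind a ≼ bind b
  bind-≼ (pa , a⊑b) = Proper-bind pa , unbind-⊑ a⊑b

  ≼-⊗ʳ : {a b : Profile m} (c : Profile m) → a ≼ b → Proper (b ⊗ c) → a ⊗ c ≼ b ⊗ c
  ≼-⊗ʳ c ((la , _) , a⊑b) ((_ , lc) , u) = ((la , lc) , Unique-⊑ ac⊑bc u) , ac⊑bc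
    where ac⊑bc = ⊑-++⁺ʳ (names c) a⊑b

  Proper-closed : {a : Profile m} → linear a → names a ≡ [] → Proper a
  Proper-closed la a≡[] = la , subst Unique (≡.sym a≡[]) []

  closed-≼ : {a b : Profile m} → linear a → names a ≡ [] → a ≼ b
  closed-≼ la a≡[] = Proper-closed la a≡[] , subst (_⊑ _) (≡.sym a≡[]) []⊑

  unshift-ext : (χ : Fin m → Fin m') (i : Fin (suc m)) → unshift (ext χ i) ≡ Maybe.map χ (unshift i)
  unshift-ext χ zero    = refl
  unshift-ext χ (suc i) = refl

  unbind-map-ext : (χ : Fin m → Fin m') (xs : List (Fin (suc m))) →
                   unbind (map (ext χ) xs) ≡ map χ (unbind xs)
  unbind-map-ext χ xs = begin
    mapMaybe unshift (map (ext χ) xs)    ≡⟨ mapMaybe-map unshift (ext χ) xs ⟩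
    mapMaybe (unshift ∘ ext χ) xs        ≡⟨ mapMaybe-cong (unshift-ext χ) xs ⟩
    mapMaybe (Maybe.map χ ∘ unshift) xs  ≡⟨ map-mapMaybe χ unshift xs ⟨
    map χ (mapMaybe unshift xs)          ∎
    where open ≡.≡-Reasoning

  mutual
    fv-ren : (ρ : Fin n → Fin n') (χ : Fin m → Fin m') (P : Proc n m) → fv (ren ρ χ P) ≡ map χ (fv P)
    fv-ren ρ χ (sm M)      = fvS-ren ρ χ M
    fv-ren ρ χ (P ∣ Q)     =
      ≡.trans (≡.cong₂ _++_ (fv-ren ρ χ P) (fv-ren ρ χ Q)) (≡.sym (map-++ χ (fv P) (fv Q)))
    fv-ren ρ χ (νc P)      = fv-ren (ext ρ) χ P
    fv-ren ρ χ (νs _ P)    = ≡.trans (cong unbind (fv-ren ρ (ext χ) P)) (unbind-map-ext χ (fv P))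
    fv-ren ρ χ (call _ _)  = refl

    fvS-ren : (ρ : Fin n → Fin n') (χ : Fin m → Fin m') (M : Sum n m) → fvS (renS ρ χ M) ≡ map χ (fvS M)
    fvS-ren ρ χ 𝟘           = refl
    fvS-ren ρ χ (M ⊕ N)     =
      ≡.trans (≡.cong₂ _++_ (fvS-ren ρ χ M) (fvS-ren ρ χ N)) (≡.sym (map-++ χ (fvS M) (fvS N)))
    fvS-ren ρ χ (out _ _ P) = fv-ren ρ χ P
    fvS-ren ρ χ (inp _ P)   = fv-ren (ext ρ) χ P
    fvS-ren ρ χ (tau P)     = fv-ren ρ χ P
    fvS-ren ρ χ (rate _ P)  = fv-ren ρ χ P
    fvS-ren ρ χ (sto q P)   = cong (χ q ∷_) (fv-ren ρ χ P)

  closed-ren : (ρ : Fin n → Fin n') (χ : Fin m → Fin m') (P : Proc n m) →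
               fv P ≡ [] → fv (ren ρ χ P) ≡ []
  closed-ren ρ χ P closed = ≡.trans (fv-ren ρ χ P) (cong (map χ) closed)

  closed-ren⁻ : (ρ : Fin n → Fin n') (χ : Fin m → Fin m') (P : Proc n m) →
                fv (ren ρ χ P) ≡ [] → fv P ≡ []
  closed-ren⁻ ρ χ P closed = map-≡[]⁻ (fv P) (≡.trans (≡.sym (fv-ren ρ χ P)) closed)

  ext-injective : {χ : Fin m → Fin m'} → Injective _≡_ _≡_ χ → Injective _≡_ _≡_ (ext χ)
  ext-injective χ-inj {zero}  {zero}  _  = refl
  ext-injective χ-inj {suc i} {suc j} eq = cong suc (χ-inj (suc-injective eq))

  mutual
    Linear-ren : (ρ : Fin n → Fin n') {χ : Fin m → Fin m'} → Injective _≡_ _≡_ χ →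
                 (P : Proc n m) → Linear P → Linear (ren ρ χ P)
    Linear-ren ρ χ-inj (sm M)          lin       = LinearS-ren ρ χ-inj M lin
    Linear-ren ρ χ-inj (P ∣ Q)         (lP , lQ) = Linear-ren ρ χ-inj P lP , Linear-ren ρ χ-inj Q lQ
    Linear-ren ρ χ-inj (νc P)          lin       = Linear-ren (ext ρ) χ-inj P lin
    Linear-ren ρ {χ} χ-inj (νs _ P)    (lP , u)  =
      Linear-ren ρ (ext-injective χ-inj) P lP ,
      subst Unique (≡.sym (fv-ren ρ (ext χ) P)) (Unique.map⁺ (ext-injective χ-inj) u)
    Linear-ren ρ χ-inj (call _ _)      _         = tt

    LinearS-ren : (ρ : Fin n → Fin n') {χ : Fin m → Fin m'} → Injective _≡_ _≡_ χ →
                  (M : Sum n m) → LinearS M → LinearS (renS ρ χ M)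
    LinearS-ren ρ χ-inj 𝟘               _         = tt
    LinearS-ren ρ χ-inj (M ⊕ N)         (lM , lN) = LinearS-ren ρ χ-inj M lM , LinearS-ren ρ χ-inj N lN
    LinearS-ren ρ {χ} χ-inj (out _ _ P) (lP , c)  = Linear-ren ρ χ-inj P lP , closed-ren ρ χ P c
    LinearS-ren ρ {χ} χ-inj (inp _ P)   (lP , c)  = Linear-ren (ext ρ) χ-inj P lP , closed-ren (ext ρ) χ P c
    LinearS-ren ρ {χ} χ-inj (tau P)     (lP , c)  = Linear-ren ρ χ-inj P lP , closed-ren ρ χ P c
    LinearS-ren ρ {χ} χ-inj (rate _ P)  (lP , c)  = Linear-ren ρ χ-inj P lP , closed-ren ρ χ P c
    LinearS-ren ρ {χ} χ-inj (sto _ P)   (lP , c)  = Linear-ren ρ χ-inj P lP , closed-ren ρ χ P c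

  mutual
    Linear-ren⁻ : (ρ : Fin n → Fin n') (χ : Fin m → Fin m') (P : Proc n m) →
                  Linear (ren ρ χ P) → Linear P
    Linear-ren⁻ ρ χ (sm M)      lin       = LinearS-ren⁻ ρ χ M lin
    Linear-ren⁻ ρ χ (P ∣ Q)     (lP , lQ) = Linear-ren⁻ ρ χ P lP , Linear-ren⁻ ρ χ Q lQ
    Linear-ren⁻ ρ χ (νc P)      lin       = Linear-ren⁻ (ext ρ) χ P lin
    Linear-ren⁻ ρ χ (νs _ P)    (lP , u)  =
      Linear-ren⁻ ρ (ext χ) P lP , Unique.map⁻ (subst Unique (fv-ren ρ (ext χ) P) u)
    Linear-ren⁻ ρ χ (call _ _)  _         = tt

    LinearS-ren⁻ : (ρ : Fin n → Fin n') (χ : Fin m → Fin m') (M : Sum n m) →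
                   LinearS (renS ρ χ M) → LinearS M
    LinearS-ren⁻ ρ χ 𝟘           _         = tt
    LinearS-ren⁻ ρ χ (M ⊕ N)     (lM , lN) = LinearS-ren⁻ ρ χ M lM , LinearS-ren⁻ ρ χ N lN
    LinearS-ren⁻ ρ χ (out _ _ P) (lP , c)  = Linear-ren⁻ ρ χ P lP , closed-ren⁻ ρ χ P c
    LinearS-ren⁻ ρ χ (inp _ P)   (lP , c)  = Linear-ren⁻ (ext ρ) χ P lP , closed-ren⁻ (ext ρ) χ P c
    LinearS-ren⁻ ρ χ (tau P)     (lP , c)  = Linear-ren⁻ ρ χ P lP , closed-ren⁻ ρ χ P c
    LinearS-ren⁻ ρ χ (rate _ P)  (lP , c)  = Linear-ren⁻ ρ χ P lP , closed-ren⁻ ρ χ P c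
    LinearS-ren⁻ ρ χ (sto _ P)   (lP , c)  = Linear-ren⁻ ρ χ P lP , closed-ren⁻ ρ χ P c

  ext-cong : {ρ ρ' : Fin n → Fin n'} → ρ ≗ ρ' → ext ρ ≗ ext ρ'
  ext-cong ρ≗ρ' zero    = refl
  ext-cong ρ≗ρ' (suc i) = cong suc (ρ≗ρ' i)

  ext-idF : ext (idF {n}) ≗ idF
  ext-idF zero    = refl
  ext-idF (suc i) = refl

  mutual
    ren-cong : {ρ ρ' : Fin n → Fin n'} {χ χ' : Fin m → Fin m'} → ρ ≗ ρ' → χ ≗ χ' →
               (P : Proc n m) → ren ρ χ P ≡ ren ρ' χ' P
    ren-cong ρ≗ρ' χ≗χ' (sm M)      = cong sm (renS-cong ρ≗ρ' χ≗χ' M)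
    ren-cong ρ≗ρ' χ≗χ' (P ∣ Q)     = ≡.cong₂ _∣_ (ren-cong ρ≗ρ' χ≗χ' P) (ren-cong ρ≗ρ' χ≗χ' Q)
    ren-cong ρ≗ρ' χ≗χ' (νc P)      = cong νc (ren-cong (ext-cong ρ≗ρ') χ≗χ' P)
    ren-cong ρ≗ρ' χ≗χ' (νs l P)    = cong (νs l) (ren-cong ρ≗ρ' (ext-cong χ≗χ') P)
    ren-cong ρ≗ρ' χ≗χ' (call k ys) = cong (call k) (Vec.map-cong ρ≗ρ' ys)

    renS-cong : {ρ ρ' : Fin n → Fin n'} {χ χ' : Fin m → Fin m'} → ρ ≗ ρ' → χ ≗ χ' →
                (M : Sum n m) → renS ρ χ M ≡ renS ρ' χ' M
    renS-cong ρ≗ρ' χ≗χ' 𝟘           = refl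
    renS-cong ρ≗ρ' χ≗χ' (M ⊕ N)     = ≡.cong₂ _⊕_ (renS-cong ρ≗ρ' χ≗χ' M) (renS-cong ρ≗ρ' χ≗χ' N)
    renS-cong ρ≗ρ' χ≗χ' (out x y P) rewrite ρ≗ρ' x | ρ≗ρ' y = cong (out _ _) (ren-cong ρ≗ρ' χ≗χ' P)
    renS-cong ρ≗ρ' χ≗χ' (inp x P)   = ≡.cong₂ inp (ρ≗ρ' x) (ren-cong (ext-cong ρ≗ρ') χ≗χ' P)
    renS-cong ρ≗ρ' χ≗χ' (tau P)     = cong tau (ren-cong ρ≗ρ' χ≗χ' P)
    renS-cong ρ≗ρ' χ≗χ' (rate l P)  = cong (rate l) (ren-cong ρ≗ρ' χ≗χ' P)
    renS-cong ρ≗ρ' χ≗χ' (sto q P)   = ≡.cong₂ sto (χ≗χ' q) (ren-cong ρ≗ρ' χ≗χ' P)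

  swap-involutive : (i : Fin (suc (suc m))) → swap (swap i) ≡ i
  swap-involutive zero          = refl
  swap-involutive (suc zero)    = refl
  swap-involutive (suc (suc i)) = refl

  swap-injective : Injective _≡_ _≡_ (swap {m})
  swap-injective {x = i} {j} eq =
    ≡.trans (≡.sym (swap-involutive i)) (≡.trans (cong swap eq) (swap-involutive j))

  unbind²-map-swap : (xs : List (Fin (suc (suc m)))) → unbind (unbind (map swap xs)) ≡ unbind (unbind xs)
  unbind²-map-swap []                 = refl
  unbind²-map-swap (zero ∷ xs)        = unbind²-map-swap xs
  unbind²-map-swap (suc zero ∷ xs)    = unbind²-map-swap xs
  unbind²-map-swap (suc (suc i) ∷ xs) = cong (i ∷_) (unbind²-map-swap xs)

  noStoch-injective : Injective _≡_ _≡_ (noStoch {m})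
  noStoch-injective {x = ()}

  ≃-renC : (ρ : Fin n → Fin n') (P : Proc n m) → ⟪ ren ρ idF P ⟫ ≃ ⟪ P ⟫
  ≃-renC ρ P = record
    { names-↭ = ↭-reflexive (≡.trans (fv-ren ρ idF P) (map-id (fv P)))
    ; linear⇒ = Linear-ren⁻ ρ idF P ∘ proj₁
    ; linear⇐ = Linear-ren ρ (λ eq → eq) P ∘ proj₁
    }

  ≃-swap : (P : Proc n (suc (suc m))) → bind (bind ⟪ P ⟫) ≃ bind (bind ⟪ ren idF swap P ⟫)
  ≃-swap P = record
    { names-↭ = ↭-reflexive (≡.sym (≡.trans (cong (unbind ∘ unbind) fv-swap) (unbind²-map-swap (fv P))))
    ; linear⇒ = λ { (((lP , uP) , _) , _) →
        let u = subst Unique (≡.sym fv-swap) (Unique.map⁺ swap-injective uP)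
        in (Linear-ren idF swap-injective P lP , u) , Unique-unbind u }
    ; linear⇐ = λ { (((lP , uP) , _) , _) →
        let u = Unique.map⁻ (subst Unique fv-swap uP)
        in (Linear-ren⁻ idF swap P lP , u) , Unique-unbind u }
    }
    where
    fv-swap : fv (ren idF swap P) ≡ map swap (fv P)
    fv-swap = fv-ren idF swap P

  ≃-extrude : (P : Proc n (suc m)) (Q : Proc n m) →
              bind ⟪ P ⟫ ⊗ ⟪ Q ⟫ ≃ bind (⟪ P ⟫ ⊗ ⟪ wkS Q ⟫)
  ≃-extrude P Q = record
    { names-↭ = ↭-reflexive (≡.sym (begin
        unbind (fv P ++ fv (wkS Q))               ≡⟨ mapMaybe-++ unshift (fv P) (fv (wkS Q)) ⟩
        unbind (fv P) ++ unbind (fv (wkS Q))      ≡⟨ cong (λ ys → unbind (fv P) ++ unbind ys) fv-wkS ⟩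
        unbind (fv P) ++ unbind (map suc (fv Q))  ≡⟨ cong (unbind (fv P) ++_) (unbind-map-suc (fv Q)) ⟩
        unbind (fv P) ++ fv Q                     ∎))
    ; linear⇒ = λ { (((lP , uP) , lQ) , u) →
        (lP , Linear-ren idF suc-injective Q lQ) ,
        subst (λ ys → Unique (fv P ++ ys)) (≡.sym fv-wkS) (Unique-extrude uP u) }
    ; linear⇐ = λ { (((lP , lwQ) , u) , _) → (lP , Unique-++⁻ˡ (fv P) u) , Linear-ren⁻ idF suc Q lwQ }
    }
    where
    open ≡.≡-Reasoning
    fv-wkS : fv (wkS Q) ≡ map suc (fv Q)
    fv-wkS = fv-ren idF suc Q

  ≃-rateν : ∀ {l} (P : Proc n m) (M : Sum n m) →
            ⟪ sm (rate l P ⊕ M) ⟫ ≃ ⟪ νs l (sm (sto zero (wkS P) ⊕ wkSumS M)) ⟫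
  ≃-rateν P M = record
    { names-↭ = ↭-reflexive (≡.sym (≡.trans (cong unbind fv-wk) (unbind-map-suc (fv P ++ fvS M))))
    ; linear⇒ = λ { (((lP , cP) , lM) , u) →
        ((Linear-ren idF suc-injective P lP , closed-ren idF suc P cP) , LinearS-ren idF suc-injective M lM) ,
        subst (Unique ∘ (zero ∷_)) (≡.sym fv-wk) (Unique-zero∷map-suc u) }
    ; linear⇐ = λ { ((((lP , cP) , lM) , _) , _) →
        (Linear-ren⁻ idF suc P lP , closed-ren⁻ idF suc P cP) , LinearS-ren⁻ idF suc M lM }
    }
    where
    fv-wk : fv (wkS P) ++ fvS (wkSumS M) ≡ map suc (fv P ++ fvS M)
    fv-wk = ≡.trans (≡.cong₂ _++_ (fv-ren idF suc P) (fvS-ren idF suc M)) (≡.sym (map-++ suc (fv P) (fvS M)))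

  mutual
    IsStd⇒closed : {P : Proc n m} → IsStd P → Linear P × fv P ≡ []
    IsStd⇒closed (sm std)    = IsStdS⇒closed std
    IsStd⇒closed (par sP sQ) =
      let lP , cP = IsStd⇒closed sP ; lQ , cQ = IsStd⇒closed sQ in (lP , lQ) , ≡.cong₂ _++_ cP cQ
    IsStd⇒closed (νc std)    = IsStd⇒closed std
    IsStd⇒closed call        = tt , refl

    IsStdS⇒closed : {M : Sum n m} → IsStdS M → LinearS M × fvS M ≡ []
    IsStdS⇒closed 𝟘           = tt , refl
    IsStdS⇒closed (sM ⊕ sN)   =
      let lM , cM = IsStdS⇒closed sM ; lN , cN = IsStdS⇒closed sN in (lM , lN) , ≡.cong₂ _++_ cM cN
    IsStdS⇒closed (out std)   = let lP , c = IsStd⇒closed std in (lP , c) , c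
    IsStdS⇒closed (inp std)   = let lP , c = IsStd⇒closed std in (lP , c) , c
    IsStdS⇒closed (tau std)   = let lP , c = IsStd⇒closed std in (lP , c) , c
    IsStdS⇒closed (rate std)  = let lP , c = IsStd⇒closed std in (lP , c) , c

  IsStd⇒Proper : {P : Proc n m} → IsStd P → Proper ⟪ P ⟫
  IsStd⇒Proper std = let lP , c = IsStd⇒closed std in Proper-closed lP c


  mutual
    data BinderFree {n m : ℕ} : Proc n m → Set where
      sm   : ∀ {M} → BinderFreeS M → BinderFree (sm M)
      par  : ∀ {P Q} → BinderFree P → BinderFree Q → BinderFree (P ∣ Q)
      νc   : ∀ {P} → BinderFree P → BinderFree (νc P)
      call : ∀ {k ys} → BinderFree (call k ys)

    data BinderFreeS {n m : ℕ} : Sum n m → Set where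
      𝟘    : BinderFreeS 𝟘
      _⊕_  : ∀ {M N} → BinderFreeS M → BinderFreeS N → BinderFreeS (M ⊕ N)
      out  : ∀ {x y P} → BinderFree P → BinderFreeS (out x y P)
      inp  : ∀ {x P} → BinderFree P → BinderFreeS (inp x P)
      tau  : ∀ {P} → BinderFree P → BinderFreeS (tau P)
      rate : ∀ {l P} → BinderFree P → BinderFreeS (rate l P)
      sto  : ∀ {q P} → BinderFree P → BinderFreeS (sto q P)

  mutual
    BinderFree-closed⇒IsStd : {P : Proc n m} → BinderFree P → fv P ≡ [] → IsStd P
    BinderFree-closed⇒IsStd (sm bf)                 c = sm (BinderFreeS-closed⇒IsStdS bf c)
    BinderFree-closed⇒IsStd (par {P} {Q} bfP bfQ)   c =
      par (BinderFree-closed⇒IsStd bfP (++-conicalˡ (fv P) (fv Q) c))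
          (BinderFree-closed⇒IsStd bfQ (++-conicalʳ (fv P) (fv Q) c))
    BinderFree-closed⇒IsStd (νc bf)                 c = νc (BinderFree-closed⇒IsStd bf c)
    BinderFree-closed⇒IsStd call                    _ = call

    BinderFreeS-closed⇒IsStdS : {M : Sum n m} → BinderFreeS M → fvS M ≡ [] → IsStdS M
    BinderFreeS-closed⇒IsStdS 𝟘                     _ = 𝟘
    BinderFreeS-closed⇒IsStdS (_⊕_ {M} {N} bfM bfN) c =
      BinderFreeS-closed⇒IsStdS bfM (++-conicalˡ (fvS M) (fvS N) c) ⊕
      BinderFreeS-closed⇒IsStdS bfN (++-conicalʳ (fvS M) (fvS N) c)
    BinderFreeS-closed⇒IsStdS (out bf)              c = out (BinderFree-closed⇒IsStd bf c)
    BinderFreeS-closed⇒IsStdS (inp bf)              c = inp (BinderFree-closed⇒IsStd bf c)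
    BinderFreeS-closed⇒IsStdS (tau bf)              c = tau (BinderFree-closed⇒IsStd bf c)
    BinderFreeS-closed⇒IsStdS (rate bf)             c = rate (BinderFree-closed⇒IsStd bf c)

  ren-ext-idF : {χ : Fin m → Fin m'} (P : Proc (suc n) m) → ren (ext idF) χ P ≡ ren idF χ P
  ren-ext-idF P = ren-cong ext-idF (λ _ → refl) P

  mutual
    strengthen : (Q : Proc n (suc m)) → BinderFree Q → zero ∉ fv Q →
                 Σ (Proc n m) λ Q' → BinderFree Q' × wkS Q' ≡ Q
    strengthen (sm M) (sm bf) 0∉ =
      let M' , bf' , eq = strengthenS M bf 0∉ in sm M' , sm bf' , cong sm eq
    strengthen (P ∣ Q) (par bfP bfQ) 0∉ =
      let P' , bfP' , eqP = strengthen P bfP (0∉ ∘ ∈-++⁺ˡ)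
          Q' , bfQ' , eqQ = strengthen Q bfQ (0∉ ∘ ∈-++⁺ʳ (fv P))
      in (P' ∣ Q') , par bfP' bfQ' , ≡.cong₂ _∣_ eqP eqQ
    strengthen (νc P) (νc bf) 0∉ =
      let P' , bf' , eq = strengthen P bf 0∉ in νc P' , νc bf' , cong νc (≡.trans (ren-ext-idF P') eq)
    strengthen (call k ys) call _ = call k ys , call , cong (call k) (Vec.map-id ys)

    strengthenS : (M : Sum n (suc m)) → BinderFreeS M → zero ∉ fvS M →
                  Σ (Sum n m) λ M' → BinderFreeS M' × wkSumS M' ≡ M
    strengthenS 𝟘 𝟘 _ = 𝟘 , 𝟘 , refl
    strengthenS (M ⊕ N) (bfM ⊕ bfN) 0∉ =
      let M' , bfM' , eqM = strengthenS M bfM (0∉ ∘ ∈-++⁺ˡ)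
          N' , bfN' , eqN = strengthenS N bfN (0∉ ∘ ∈-++⁺ʳ (fvS M))
      in (M' ⊕ N') , (bfM' ⊕ bfN') , ≡.cong₂ _⊕_ eqM eqN
    strengthenS (out x y P) (out bf) 0∉ =
      let P' , bf' , eq = strengthen P bf 0∉ in out x y P' , out bf' , cong (out x y) eq
    strengthenS (inp x P) (inp bf) 0∉ =
      let P' , bf' , eq = strengthen P bf 0∉ in inp x P' , inp bf' , cong (inp x) (≡.trans (ren-ext-idF P') eq)
    strengthenS (tau P) (tau bf) 0∉ =
      let P' , bf' , eq = strengthen P bf 0∉ in tau P' , tau bf' , cong tau eq
    strengthenS (rate l P) (rate bf) 0∉ =
      let P' , bf' , eq = strengthen P bf 0∉ in rate l P' , rate bf' , cong (rate l) eq
    strengthenS (sto zero P) (sto bf) 0∉ = ⊥-elim (0∉ (here refl))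
    strengthenS (sto (suc q) P) (sto bf) 0∉ =
      let P' , bf' , eq = strengthen P bf (0∉ ∘ there) in sto q P' , sto bf' , cong (sto (suc q)) eq

  module WithStandardDefs (body : (k : K) → Proc (ar k) 0) (body-std : ∀ k → IsStd (body k)) where
    open WithDefs body

    ≃-unfold : ∀ k (ys : Vec (Fin n) (ar k)) → ⟪ call {n} {m} k ys ⟫ ≃ ⟪ inst k ys (body k) ⟫
    ≃-unfold k ys = record
      { names-↭ = ↭-reflexive (≡.sym (closed-ren (Vec.lookup ys) noStoch (body k) closed))
      ; linear⇒ = λ _ → Linear-ren (Vec.lookup ys) noStoch-injective (body k) body-linear
      ; linear⇐ = λ _ → tt
      }
      where
      body-linear : Linear (body k)
      body-linear = proj₁ (IsStd⇒closed (body-std k))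
      closed : fv (body k) ≡ []
      closed = proj₂ (IsStd⇒closed (body-std k))

    mutual
      ≈⇒≃ : {P Q : Proc n m} → P ≈P Q → ⟪ P ⟫ ≃ ⟪ Q ⟫
      ≈⇒≃ refl          = ≃-refl
      ≈⇒≃ (sym p)       = ≃-sym (≈⇒≃ p)
      ≈⇒≃ (trans p q)   = ≃-trans (≈⇒≃ p) (≈⇒≃ q)
      ≈⇒≃ (sm p)        = ≈S⇒≃ p
      ≈⇒≃ (par p q)     = ≃-⊗ (≈⇒≃ p) (≈⇒≃ q)
      ≈⇒≃ (νc p)        = ≈⇒≃ p
      ≈⇒≃ (νs p)        = ≃-bind (≈⇒≃ p)
      ≈⇒≃ (extrC {Q = Q}) = ≃-⊗ ≃-refl (≃-sym (≃-renC suc Q))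
      ≈⇒≃ (extrS {P = P} {Q}) = ≃-extrude P Q
      ≈⇒≃ (swapCC {P = P}) = ≃-sym (≃-renC swap P)
      ≈⇒≃ (swapSS {P = P}) = ≃-swap P
      ≈⇒≃ swapCS        = ≃-refl
      ≈⇒≃ nilC          = ≃-refl
      ≈⇒≃ nilS          = record
        { names-↭ = ↭-refl ; linear⇒ = λ _ → tt ; linear⇐ = λ _ → tt , [] }
      ≈⇒≃ (parA {P = P} {Q} {R}) = ⊗-assoc ⟪ P ⟫ ⟪ Q ⟫ ⟪ R ⟫
      ≈⇒≃ (parC {P = P} {Q}) = ⊗-comm ⟪ P ⟫ ⟪ Q ⟫
      ≈⇒≃ (parU {P = P}) = ⊗-identityʳ ⟪ P ⟫
      ≈⇒≃ (unfold {k = k} {ys}) = ≃-unfold k ys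
      ≈⇒≃ (rateν {l = l} {P = P} {M}) = ≃-rateν {l = l} P M

      ≈S⇒≃ : {M N : Sum n m} → M ≈S N → ⟪ M ⟫ˢ ≃ ⟪ N ⟫ˢ
      ≈S⇒≃ refl         = ≃-refl
      ≈S⇒≃ (sym p)      = ≃-sym (≈S⇒≃ p)
      ≈S⇒≃ (trans p q)  = ≃-trans (≈S⇒≃ p) (≈S⇒≃ q)
      ≈S⇒≃ (sum p q)    = ≃-⊗ (≈S⇒≃ p) (≈S⇒≃ q)
      ≈S⇒≃ (out p)      = ≃-guard (≈⇒≃ p)
      ≈S⇒≃ (inp p)      = ≃-guard (≈⇒≃ p)
      ≈S⇒≃ (tau p)      = ≃-guard (≈⇒≃ p)
      ≈S⇒≃ (rate p)     = ≃-guard (≈⇒≃ p)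
      ≈S⇒≃ (sto {q = q} p) = record
        { names-↭ = ↭-prep q (names-↭ P≃P')
        ; linear⇒ = linear-guard-resp-≃ P≃P' ∘ proj₁
        ; linear⇐ = linear-guard-resp-≃ (≃-sym P≃P') ∘ proj₁
        }
        where P≃P' = ≈⇒≃ p
      ≈S⇒≃ (sumA {M = M} {N} {L}) = ⊗-assoc ⟪ M ⟫ˢ ⟪ N ⟫ˢ ⟪ L ⟫ˢ
      ≈S⇒≃ (sumC {M = M} {N}) = ⊗-comm ⟪ M ⟫ˢ ⟪ N ⟫ˢ
      ≈S⇒≃ (sumU {M = M}) = ⊗-identityʳ ⟪ M ⟫ˢ

    —→-≼ : ∀ {l} {P P' : Proc n m} → P —[ l ]→ P' → Proper ⟪ P ⟫ → ⟪ P' ⟫ ≼ ⟪ P ⟫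
    —→-≼ stoT (((lP , cP) , _) , _) = closed-≼ lP cP
    —→-≼ tauT (((lP , cP) , _) , _) = closed-≼ lP cP
    —→-≼ (comT {y = y} {P = P}) ((((lP , cP) , _) , ((lQ , cQ) , _)) , _) =
      closed-≼ (Linear-ren (sub0 y) (λ eq → eq) P lP , lQ)
               (≡.cong₂ _++_ (closed-ren (sub0 y) idF P cP) cQ)
    —→-≼ (parT {P = P} {Q = Q} step) pPQ =
      ≼-⊗ʳ ⟪ Q ⟫ (—→-≼ step (proj₁ (Proper-⊗⁻ ⟪ P ⟫ ⟪ Q ⟫ pPQ))) pPQ
    —→-≼ (resC step) pP = —→-≼ step pP
    —→-≼ (resS step) (pP , _) = bind-≼ (—→-≼ step pP)
    —→-≼ (congT P≈Q step Q'≈P') pP =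
      ≼-resp-≃ (≈⇒≃ Q'≈P') (≃-sym P≃Q) (—→-≼ step (Proper-resp-≃ P≃Q pP))
      where P≃Q = ≈⇒≃ P≈Q

    StoRules-≼ : ∀ {S : StoRel} {P : Proc n m} {σ} → StoRules S P σ → Proper ⟪ P ⟫ →
                 ∀ {l Q} → (l , Q) ∈ σ → ⟪ Q ⟫ ≼ ⟪ P ⟫
    StoRules-≼ (sto1 {l = l} {σ = σ} rules step) (pP , _) Q∈ with ∈-++⁻ (νDist l σ) Q∈
    ... | inj₁ Q∈νσ with ∈-map⁻ _ Q∈νσ
    ...   | _ , R∈σ , refl = bind-≼ (StoRules-≼ rules pP R∈σ)
    StoRules-≼ (sto1 rules step) (pP , _) Q∈ | inj₂ (here refl) = bind-≼ (—→-≼ step pP)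
    StoRules-≼ (sto2 _ step) (pP , _) (here refl) = bind-≼ (—→-≼ step pP)
    StoRules-≼ (stoCong P≈Q rules) pP Q∈ =
      ≼-resp-≃ ≃-refl (≃-sym P≃Q) (StoRules-≼ rules (Proper-resp-≃ P≃Q pP) Q∈)
      where P≃Q = ≈⇒≃ P≈Q

    ≈P-setoid : ℕ → ℕ → Setoid _ _
    ≈P-setoid n m = record
      { Carrier = Proc n m
      ; _≈_ = _≈P_
      ; isEquivalence = record { refl = refl ; sym = sym ; trans = trans }
      }

    νs-wkS : ∀ {l} (P : Proc n m) → νs l (wkS P) ≈P P
    νs-wkS {n} {m} {l} P = begin
      νs l (wkS P)                ≈⟨ νs (trans parC parU) ⟨
      νs l (sm 𝟘 ∣ wkS P)         ≈⟨ extrS ⟨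
      νs l (sm 𝟘) ∣ P             ≈⟨ par nilS refl ⟩
      sm 𝟘 ∣ P                    ≈⟨ trans parC parU ⟩
      P                           ∎
      where open ≈-Reasoning (≈P-setoid n m)

    record Isolated (M : Sum n (suc m)) : Set where
      constructor isolated
      field
        {R}           : Proc n m
        {rest}        : Sum n m
        R-binderFree    : BinderFree R
        rest-binderFree : BinderFreeS rest
        split           : M ≈S sto zero (wkS R) ⊕ wkSumS rest

    ≡⇒≈P : {P Q : Proc n m} → P ≡ Q → P ≈P Q
    ≡⇒≈P refl = refl

    ≡⇒≈S : {M N : Sum n m} → M ≡ N → M ≈S N
    ≡⇒≈S refl = refl

    isolate : (M : Sum n (suc m)) → BinderFreeS M → Proper ⟪ M ⟫ˢ → zero ∈ fvS M → Isolated M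
    isolate (M ⊕ N) (bfM ⊕ bfN) pMN 0∈ with Proper-⊗⁻ ⟪ M ⟫ˢ ⟪ N ⟫ˢ pMN | ∈-++⁻ (fvS M) 0∈
    ... | pM , _ | inj₁ 0∈M =
      let isolated bfR bfM' M≈ = isolate M bfM pM 0∈M
          N' , bfN' , N'≡N = strengthenS N bfN (λ 0∈N → apart (0∈M , 0∈N))
      in isolated bfR (bfM' ⊕ bfN') (trans (sum M≈ (≡⇒≈S (≡.sym N'≡N))) sumA)
      where apart : Disjoint (fvS M) (fvS N)
            apart = Unique-++⇒Disjoint (fvS M) (proj₂ pMN)
    ... | _ , pN | inj₂ 0∈N =
      let isolated bfR bfN' N≈ = isolate N bfN pN 0∈N
          M' , bfM' , M'≡M = strengthenS M bfM (λ 0∈M → apart (0∈M , 0∈N))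
      in isolated bfR (bfN' ⊕ bfM') (trans sumC (trans (sum N≈ (≡⇒≈S (≡.sym M'≡M))) sumA))
      where apart : Disjoint (fvS M) (fvS N)
            apart = Unique-++⇒Disjoint (fvS M) (proj₂ pMN)
    isolate (sto zero P) (sto bf) ((_ , closed) , _) _ =
      let P' , bfP' , P'≡P = strengthen P bf (≡[]⇒∉ closed)
      in isolated bfP' 𝟘 (trans (sym sumU) (sum (sto (≡⇒≈P (≡.sym P'≡P))) refl))
    isolate (sto (suc q) P) _ ((_ , closed) , _) (there 0∈P) = ⊥-elim (≡[]⇒∉ closed 0∈P)
    isolate (out _ _ P) _ ((_ , closed) , _) 0∈P = ⊥-elim (≡[]⇒∉ closed 0∈P)
    isolate (inp _ P)   _ ((_ , closed) , _) 0∈P = ⊥-elim (≡[]⇒∉ closed 0∈P)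
    isolate (tau P)     _ ((_ , closed) , _) 0∈P = ⊥-elim (≡[]⇒∉ closed 0∈P)
    isolate (rate _ P)  _ ((_ , closed) , _) 0∈P = ⊥-elim (≡[]⇒∉ closed 0∈P)

    BinderFreeForm : ∀ {n m} → Proc n m → Set
    BinderFreeForm {n} {m} P = Σ (Proc n m) λ Z → BinderFree Z × Z ≈P P

    mutual
      eliminate : ∀ {l} (Q : Proc n (suc m)) → BinderFree Q → Proper ⟪ Q ⟫ → BinderFreeForm (νs l Q)
      eliminate {l = l} Q bf pQ with any? (zero ≟_) (fv Q)
      ... | no 0∉Q = let Q' , bf' , Q'≡Q = strengthen Q bf 0∉Q
                     in Q' , bf' , trans (sym (νs-wkS Q')) (νs (≡⇒≈P Q'≡Q))
      ... | yes 0∈Q = eliminate-occurring Q bf pQ 0∈Q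

      eliminate-occurring : ∀ {l} (Q : Proc n (suc m)) → BinderFree Q → Proper ⟪ Q ⟫ → zero ∈ fv Q →
                            BinderFreeForm (νs l Q)
      eliminate-occurring {l = l} (sm M) (sm bf) pM 0∈ =
        let isolated {R} {rest} bfR bfRest M≈ = isolate M bf pM 0∈
        in sm (rate l R ⊕ rest) , sm (rate bfR ⊕ bfRest) , trans rateν (νs (sm (sym M≈)))
      eliminate-occurring (P ∣ Q) (par bfP bfQ) pPQ 0∈ with ∈-++⁻ (fv P) 0∈
      ... | inj₁ 0∈P =
        eliminate-parˡ P Q bfP bfQ (proj₁ (Proper-⊗⁻ ⟪ P ⟫ ⟪ Q ⟫ pPQ)) 0∈P (λ 0∈Q → apart (0∈P , 0∈Q))
        where apart : Disjoint (fv P) (fv Q)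
              apart = Unique-++⇒Disjoint (fv P) (proj₂ pPQ)
      ... | inj₂ 0∈Q =
        let Z , bf , Z≈ =
              eliminate-parˡ Q P bfQ bfP (proj₂ (Proper-⊗⁻ ⟪ P ⟫ ⟪ Q ⟫ pPQ)) 0∈Q (λ 0∈P → apart (0∈P , 0∈Q))
        in Z , bf , trans Z≈ (νs parC)
        where apart : Disjoint (fv P) (fv Q)
              apart = Unique-++⇒Disjoint (fv P) (proj₂ pPQ)
      eliminate-occurring (νc P) (νc bf) pP 0∈ =
        let Z , bfZ , Z≈ = eliminate P bf pP in νc Z , νc bfZ , trans (νc Z≈) swapCS

      eliminate-parˡ : ∀ {l} (P Q : Proc n (suc m)) → BinderFree P → BinderFree Q → Proper ⟪ P ⟫ →
                       zero ∈ fv P → zero ∉ fv Q → BinderFreeForm (νs l (P ∣ Q))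
      eliminate-parˡ P Q bfP bfQ pP 0∈P 0∉Q =
        let Z , bfZ , Z≈ = eliminate-occurring P bfP pP 0∈P
            Q' , bfQ' , Q'≡Q = strengthen Q bfQ 0∉Q
        in (Z ∣ Q') , par bfZ bfQ' , trans (par Z≈ refl) (trans extrS (νs (par refl (≡⇒≈P Q'≡Q))))

    mutual
      normalise : (P : Proc n m) → Proper ⟪ P ⟫ → BinderFreeForm P
      normalise (sm M) pM =
        let Z , bf , Z≈ = normaliseS M pM in sm Z , sm bf , sm Z≈
      normalise (P ∣ Q) pPQ =
        let pP , pQ = Proper-⊗⁻ ⟪ P ⟫ ⟪ Q ⟫ pPQ
            ZP , bfP , ZP≈ = normalise P pP
            ZQ , bfQ , ZQ≈ = normalise Q pQ
        in (ZP ∣ ZQ) , par bfP bfQ , par ZP≈ ZQ≈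
      normalise (νc P) pP =
        let Z , bf , Z≈ = normalise P pP in νc Z , νc bf , νc Z≈
      normalise (νs l P) (pP , _) =
        let Z , bf , Z≈P = normalise P pP
            Z' , bf' , Z'≈ = eliminate Z bf (Proper-resp-≃ (≃-sym (≈⇒≃ Z≈P)) pP)
        in Z' , bf' , trans Z'≈ (νs Z≈P)
      normalise (call k ys) _ = call k ys , call , refl

      normaliseS : (M : Sum n m) → Proper ⟪ M ⟫ˢ → Σ (Sum n m) λ Z → BinderFreeS Z × Z ≈S M
      normaliseS 𝟘 _ = 𝟘 , 𝟘 , refl
      normaliseS (M ⊕ N) pMN =
        let pM , pN = Proper-⊗⁻ ⟪ M ⟫ˢ ⟪ N ⟫ˢ pMN
            ZM , bfM , ZM≈ = normaliseS M pM
            ZN , bfN , ZN≈ = normaliseS N pN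
        in (ZM ⊕ ZN) , (bfM ⊕ bfN) , sum ZM≈ ZN≈
      normaliseS (out x y P) ((lP , c) , _) =
        let Z , bf , Z≈ = normalise P (Proper-closed lP c) in out x y Z , out bf , out Z≈
      normaliseS (inp x P) ((lP , c) , _) =
        let Z , bf , Z≈ = normalise P (Proper-closed lP c) in inp x Z , inp bf , inp Z≈
      normaliseS (tau P) ((lP , c) , _) =
        let Z , bf , Z≈ = normalise P (Proper-closed lP c) in tau Z , tau bf , tau Z≈
      normaliseS (rate l P) ((lP , c) , _) =
        let Z , bf , Z≈ = normalise P (Proper-closed lP c) in rate l Z , rate bf , rate Z≈
      normaliseS (sto q P) ((lP , c) , _) =
        let Z , bf , Z≈ = normalise P (Proper-closed lP c) in sto q Z , sto bf , sto Z≈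

    standard-representative : {P P' : Proc n m} → IsStd P → ⟪ P' ⟫ ≼ ⟪ P ⟫ →
                              ∃ λ P'' → IsStd P'' × P'' ≈P P'
    standard-representative {P' = P'} std (pP' , P'⊑P) =
      let Z , bf , Z≈P' = normalise P' pP'
          P'-closed = ⊑[]⇒≡[] (subst (fv P' ⊑_) (proj₂ (IsStd⇒closed std)) P'⊑P)
          Z-closed = ↭.↭-empty-inv (subst (fv Z ↭_) P'-closed (names-↭ (≈⇒≃ Z≈P')))
      in Z , BinderFree-closed⇒IsStd bf Z-closed , Z≈P'

proposition9 : (Rate K : Set) (ar : K → ℕ) → let open Calculus Rate K ar in
    (body : (k : K) → Proc (ar k) 0) → (∀ k → IsStd (body k)) →
    let open WithDefs body in
    WeaklyGuarded →
    (S : StoRel) → IsStoTransition S →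
    ∀ {n m} (P P' : Proc n m) → IsStd P →
    ((P —[ nothing ]→ P') ⊎ (∃ λ σ → S P σ × ∃ λ l → (l , P') ∈D σ)) →
    ∃ λ (P'' : Proc n m) → IsStd P'' × (P'' ≈P P')
proposition9 Rate K ar body body-std _ S S-rules P P' std reduct = standard-representative std (shrinks reduct)
  where
  open Calculus Rate K ar
  open WithDefs body
  open StochasticNames Rate K ar
  open WithStandardDefs body body-std
  shrinks : (P —[ nothing ]→ P') ⊎ (∃ λ σ → S P σ × ∃ λ l → (l , P') ∈D σ) →
            ⟪ P' ⟫ ≼ ⟪ P ⟫
  shrinks (inj₁ step) = —→-≼ step (IsStd⇒Proper std)
  shrinks (inj₂ (σ , Pσ , _ , Q , Q∈σ , Q≈P')) =
    ≼-resp-≃ (≈⇒≃ Q≈P') ≃-refl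
      (StoRules-≼ (Equivalence.to (S-rules P σ) Pσ) (IsStd⇒Proper std) Q∈σ)
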